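{- (i) If $n \ge 3$ is odd, then there is a unique binary LCD $[n,n-1,2]$ code, up to equivalence. (ii) If $n \ge 2$ is even, then there are exactly $n/2$ inequivalent binary LCD $[n,n-1,1]$ codes.
   Context: All codes are binary linear codes; an $[n,k,d]$ code is a $k$-dimensional subspace of $\mathbb{F}_2^n$ with minimum nonzero Hamming weight $d$. A code $C$ is LCD if $C \cap C^\perp = \{\mathbf{0}_n\}$, where $C^\perp$ is the dual with respect to the standard inner product. Two binary codes are equivalent if one is obtained from the other by a permutation of coordinates. -}

module Defs where

open import Data.Bool using (Bool; true; false; _xor_; _∧_)
open import Data.Nat using (ℕ; zero; suc; _≤_)
open import Data.Fin using (Fin)
open import Data.Fin.Permutation using (Permutation′; _⟨$⟩ʳ_)
open import Data.Vec using (Vec; []; _∷_; zipWith; replicate; foldr; tabulate; lookup; countᵇ)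
open import Data.Product using (Σ; ∃; _×_; _,_)
open import Function using (id; _⇔_)
open import Relation.Binary.PropositionalEquality using (_≡_; _≢_)

-- Words of F₂ⁿ (false = 0, true = 1).
Word : ℕ → Set
Word n = Vec Bool n

𝟎 : ∀ {n} → Word n
𝟎 = replicate _ false

infixl 6 _⊕_
_⊕_ : ∀ {n} → Word n → Word n → Word n
_⊕_ = zipWith _xor_

_·_ : ∀ {n} → Word n → Word n → Bool
u · v = foldr _ _xor_ false (zipWith _∧_ u v)

wt : ∀ {n} → Word n → ℕ
wt = countᵇ id

Code : ℕ → Set₁
Code n = Word n → Set

combo : ∀ {n k} → Vec Bool k → Vec (Word n) k → Word n
combo [] [] = 𝟎
combo (c ∷ cs) (b ∷ bs) = zipWith _∧_ (replicate _ c) b ⊕ combo cs bs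

LinIndep : ∀ {n k} → Vec (Word n) k → Set
LinIndep b = ∀ c → combo c b ≡ 𝟎 → c ≡ replicate _ false

IsSubspaceOfDim : ∀ {n} → ℕ → Code n → Set
IsSubspaceOfDim {n} k C =
  Σ (Vec (Word n) k) λ b → LinIndep b × (∀ w → C w ⇔ (∃ λ c → combo c b ≡ w))

MinWeight : ∀ {n} → Code n → ℕ → Set
MinWeight C d =
  (∃ λ w → C w × w ≢ 𝟎 × wt w ≡ d) × (∀ w → C w → w ≢ 𝟎 → d ≤ wt w)

IsCode : ∀ n k d → Code n → Set
IsCode n k d C = IsSubspaceOfDim k C × MinWeight C d

Dual : ∀ {n} → Code n → Code n
Dual C w = ∀ c → C c → c · w ≡ false

IsLCD : ∀ {n} → Code n → Set
IsLCD C = ∀ w → C w → Dual C w → w ≡ 𝟎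

permute : ∀ {n} → Permutation′ n → Word n → Word n
permute σ w = tabulate λ i → lookup w (σ ⟨$⟩ʳ i)

Equivalent : ∀ {n} → Code n → Code n → Set
Equivalent {n} C D = ∃ λ (σ : Permutation′ n) → ∀ w → C w ⇔ D (permute σ w)

LCDCode : ∀ n k d → Code n → Set
LCDCode n k d C = IsCode n k d C × IsLCD C

module Submission where

-- An [n, n − 1] binary code C is a hyperplane. Indeed, n + 1 words of length n are
-- linearly dependent (pigeonhole: 2ⁿ⁺¹ combinations, only 2ⁿ words), so the sum of two
-- non-codewords is a codeword, i.e. the indicator of the complement of C is a linear
-- functional w ↦ h · w, and C = h⊥ for a nonzero normal vector h. Such a code is LCD
-- exactly when h · h = 1, i.e. when wt h is odd, and a coordinate permutation of C permutes
-- h, so LCD [n, n − 1] codes up to equivalence correspond to odd weights t ≤ n, represented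
-- by h = 1ᵗ0ⁿ⁻ᵗ. Minimum distance 2 means that no unit vector lies in C, which forces
-- h = 1ⁿ, an LCD normal exactly for odd n; for even n every odd t < n gives minimum
-- distance 1, so the classes are t = 1, 3, …, n − 1.

open import Defs
open import Level using (0ℓ)
open import Algebra.Bundles using (CommutativeRing)
import Algebra.Properties.CommutativeMonoid.Sum as CommutativeMonoidSum
open import Data.Bool using (Bool; true; false; _xor_; _∧_; not; _≟_; if_then_else_)
open import Data.Bool.Properties
  using (xor-assoc; xor-comm; xor-identityʳ; xor-same; ∧-comm; ∧-assoc; ∧-zeroʳ; ∧-identityʳ;
         ∧-distribˡ-xor; ∧-distribʳ-xor; xor-∧-commutativeRing; not-involutive)
open import Algebra.Properties.CommutativeSemigroup
  (CommutativeRing.+-commutativeSemigroup xor-∧-commutativeRing)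
  using () renaming (interchange to xor-interchange)
open import Data.Empty using (⊥-elim)
open import Data.Fin using (Fin; zero; suc; toℕ; fromℕ<; combine; remQuot)
open import Data.Fin.Patterns using (0F; 1F)
open import Data.Fin.Permutation as Perm using (Permutation′; _⟨$⟩ʳ_; _∘ₚ_)
open import Data.Fin.Properties
  using (pigeonhole; remQuot-combine; combine-remQuot; any?; <⇒≢; toℕ<n; toℕ-injective; toℕ-fromℕ<)
open import Data.Nat using (ℕ; zero; suc; _+_; _*_; _∸_; _/_; _≤_; _<_; _^_; z≤n; s≤s; s<s; z<s)
open import Data.Nat.DivMod using (m*n/n≡m)
open import Data.Nat.Divisibility using (_∣_; divides)
open import Data.Nat.Properties
  using (^-monoʳ-<; n<1+n; m≤n⇒m≤1+n; <⇒≤; *-monoˡ-≤; *-cancelʳ-<; *-cancelʳ-≡; suc-injective;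
         +-0-commutativeMonoid)
open import Data.Product using (∃; ∃₂; _×_; _,_; proj₁; proj₂)
open import Data.Sum using (_⊎_; inj₁; inj₂)
open import Data.Vec using (Vec; []; _∷_; zipWith; replicate; map; lookup)
open import Data.Vec.Properties
  using (map-const; map-∘; ≡-dec; ∷-injectiveˡ; ∷-injectiveʳ; lookup∘tabulate; tabulate∘lookup;
         tabulate-cong)
open import Function using (_∘_; _⇔_; Equivalence; mk⇔)
open import Function.Properties.Equivalence using (⇔-setoid) renaming (trans to ⇔-trans; sym to ⇔-sym)
open import Relation.Binary.PropositionalEquality
  using (_≡_; _≢_; refl; sym; trans; cong; cong₂; subst; module ≡-Reasoning)
import Relation.Binary.Reasoning.Setoid as SetoidReasoning
open import Relation.Nullary using (¬_; Dec; yes; no)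
open import Relation.Nullary.Decidable using (map′; isNo)
open import Relation.Unary using (Decidable)

module ⇔-Reasoning = SetoidReasoning (⇔-setoid 0ℓ)

-- Linear algebra over F₂

infixr 7 _•_
_•_ : ∀ {n} → Bool → Word n → Word n
c • w = zipWith _∧_ (replicate _ c) w

⊕-assoc : ∀ {n} (u v w : Word n) → (u ⊕ v) ⊕ w ≡ u ⊕ (v ⊕ w)
⊕-assoc [] [] [] = refl
⊕-assoc (a ∷ u) (b ∷ v) (c ∷ w) = cong₂ _∷_ (xor-assoc a b c) (⊕-assoc u v w)

⊕-comm : ∀ {n} (u v : Word n) → u ⊕ v ≡ v ⊕ u
⊕-comm [] [] = refl
⊕-comm (a ∷ u) (b ∷ v) = cong₂ _∷_ (xor-comm a b) (⊕-comm u v)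

⊕-identityˡ : ∀ {n} (u : Word n) → 𝟎 ⊕ u ≡ u
⊕-identityˡ [] = refl
⊕-identityˡ (a ∷ u) = cong (a ∷_) (⊕-identityˡ u)

⊕-identityʳ : ∀ {n} (u : Word n) → u ⊕ 𝟎 ≡ u
⊕-identityʳ u = trans (⊕-comm u 𝟎) (⊕-identityˡ u)

⊕-self : ∀ {n} (u : Word n) → u ⊕ u ≡ 𝟎
⊕-self [] = refl
⊕-self (a ∷ u) = cong₂ _∷_ (xor-same a) (⊕-self u)

⊕-cancelˡ : ∀ {n} (u v : Word n) → u ⊕ (u ⊕ v) ≡ v
⊕-cancelˡ u v = begin
  u ⊕ (u ⊕ v)  ≡⟨ sym (⊕-assoc u u v) ⟩
  (u ⊕ u) ⊕ v  ≡⟨ cong (_⊕ v) (⊕-self u) ⟩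
  𝟎 ⊕ v        ≡⟨ ⊕-identityˡ v ⟩
  v            ∎
  where open ≡-Reasoning

⊕-cancelʳ : ∀ {n} (u v : Word n) → (u ⊕ v) ⊕ v ≡ u
⊕-cancelʳ u v = trans (⊕-comm (u ⊕ v) v) (trans (cong (v ⊕_) (⊕-comm u v)) (⊕-cancelˡ v u))

⊕-interchange : ∀ {n} (u v w x : Word n) → (u ⊕ v) ⊕ (w ⊕ x) ≡ (u ⊕ w) ⊕ (v ⊕ x)
⊕-interchange [] [] [] [] = refl
⊕-interchange (a ∷ u) (b ∷ v) (c ∷ w) (d ∷ x) = cong₂ _∷_ (xor-interchange a b c d) (⊕-interchange u v w x)

⊕≡𝟎⇒≡ : ∀ {n} {u v : Word n} → u ⊕ v ≡ 𝟎 → u ≡ v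
⊕≡𝟎⇒≡ {u = u} {v} e = begin
  u                ≡⟨ sym (⊕-identityʳ u) ⟩
  u ⊕ 𝟎            ≡⟨ cong (u ⊕_) (sym e) ⟩
  u ⊕ (u ⊕ v)      ≡⟨ ⊕-cancelˡ u v ⟩
  v                ∎
  where open ≡-Reasoning

•-identityˡ : ∀ {n} (u : Word n) → true • u ≡ u
•-identityˡ [] = refl
•-identityˡ (a ∷ u) = cong (a ∷_) (•-identityˡ u)

•-zeroˡ : ∀ {n} (u : Word n) → false • u ≡ 𝟎
•-zeroˡ [] = refl
•-zeroˡ (a ∷ u) = cong (false ∷_) (•-zeroˡ u)

•-zeroʳ : ∀ {n} a → a • 𝟎 {n} ≡ 𝟎
•-zeroʳ {zero} a = refl
•-zeroʳ {suc n} a = cong₂ _∷_ (∧-zeroʳ a) (•-zeroʳ a)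

•-distribʳ-xor : ∀ {n} a b (u : Word n) → (a xor b) • u ≡ a • u ⊕ b • u
•-distribʳ-xor a b [] = refl
•-distribʳ-xor a b (x ∷ u) = cong₂ _∷_ (∧-distribʳ-xor x a b) (•-distribʳ-xor a b u)

combo-⊕ : ∀ {n k} (c d : Vec Bool k) (bs : Vec (Word n) k) →
          combo (c ⊕ d) bs ≡ combo c bs ⊕ combo d bs
combo-⊕ [] [] [] = sym (⊕-identityˡ 𝟎)
combo-⊕ (a ∷ c) (b ∷ d) (v ∷ bs) = begin
  (a xor b) • v ⊕ combo (c ⊕ d) bs                  ≡⟨ cong₂ _⊕_ (•-distribʳ-xor a b v) (combo-⊕ c d bs) ⟩
  (a • v ⊕ b • v) ⊕ (combo c bs ⊕ combo d bs)       ≡⟨ ⊕-interchange (a • v) (b • v) _ _ ⟩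
  (a • v ⊕ combo c bs) ⊕ (b • v ⊕ combo d bs)       ∎
  where open ≡-Reasoning

·-comm : ∀ {n} (u v : Word n) → u · v ≡ v · u
·-comm [] [] = refl
·-comm (a ∷ u) (b ∷ v) = cong₂ _xor_ (∧-comm a b) (·-comm u v)

𝟎-· : ∀ {n} (w : Word n) → 𝟎 · w ≡ false
𝟎-· [] = refl
𝟎-· (a ∷ w) = 𝟎-· w

·-𝟎 : ∀ {n} (w : Word n) → w · 𝟎 ≡ false
·-𝟎 w = trans (·-comm w 𝟎) (𝟎-· w)

·-distribʳ-⊕ : ∀ {n} (u v w : Word n) → (u ⊕ v) · w ≡ (u · w) xor (v · w)
·-distribʳ-⊕ [] [] [] = refl
·-distribʳ-⊕ (a ∷ u) (b ∷ v) (c ∷ w) = begin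
  ((a xor b) ∧ c) xor ((u ⊕ v) · w)            ≡⟨ cong₂ _xor_ (∧-distribʳ-xor c a b) (·-distribʳ-⊕ u v w) ⟩
  ((a ∧ c) xor (b ∧ c)) xor ((u · w) xor (v · w)) ≡⟨ xor-interchange (a ∧ c) (b ∧ c) (u · w) (v · w) ⟩
  ((a ∧ c) xor (u · w)) xor ((b ∧ c) xor (v · w)) ∎
  where open ≡-Reasoning

·-distribˡ-⊕ : ∀ {n} (w u v : Word n) → w · (u ⊕ v) ≡ (w · u) xor (w · v)
·-distribˡ-⊕ w u v = begin
  w · (u ⊕ v)          ≡⟨ ·-comm w (u ⊕ v) ⟩
  (u ⊕ v) · w          ≡⟨ ·-distribʳ-⊕ u v w ⟩
  (u · w) xor (v · w)  ≡⟨ cong₂ _xor_ (·-comm u w) (·-comm v w) ⟩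
  (w · u) xor (w · v)  ∎
  where open ≡-Reasoning

•-· : ∀ {n} c (u w : Word n) → (c • u) · w ≡ c ∧ (u · w)
•-· c [] [] = sym (∧-zeroʳ c)
•-· c (a ∷ u) (b ∷ w) = begin
  ((c ∧ a) ∧ b) xor ((c • u) · w)   ≡⟨ cong₂ _xor_ (∧-assoc c a b) (•-· c u w) ⟩
  (c ∧ (a ∧ b)) xor (c ∧ (u · w))   ≡⟨ sym (∧-distribˡ-xor c (a ∧ b) (u · w)) ⟩
  c ∧ ((a ∧ b) xor (u · w))         ∎
  where open ≡-Reasoning

IsLinear : ∀ {n} → (Word n → Bool) → Set
IsLinear f = ∀ u v → f (u ⊕ v) ≡ f u xor f v

basis : ∀ {n} → Vec (Word n) n
basis {zero} = []
basis {suc n} = (true ∷ 𝟎) ∷ map (false ∷_) basis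

combo-map-∷ : ∀ {n k} (f : Word n → Bool) (c : Vec Bool k) (vs : Vec (Word n) k) →
              combo c (map (λ v → f v ∷ v) vs) ≡ (c · map f vs) ∷ combo c vs
combo-map-∷ f [] [] = refl
combo-map-∷ f (a ∷ c) (v ∷ vs) = cong ((a • (f v ∷ v)) ⊕_) (combo-map-∷ f c vs)

combo-extend : ∀ {n k} a (c : Vec Bool k) (vs : Vec (Word n) k) →
               combo (a ∷ c) ((true ∷ 𝟎) ∷ map (false ∷_) vs) ≡ a ∷ combo c vs
combo-extend a c vs = begin
  a • (true ∷ 𝟎) ⊕ combo c (map (false ∷_) vs)
    ≡⟨ cong (a • (true ∷ 𝟎) ⊕_) (combo-map-∷ (λ _ → false) c vs) ⟩
  ((a ∧ true) xor (c · map (λ _ → false) vs)) ∷ (a • 𝟎 ⊕ combo c vs)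
    ≡⟨ cong₂ _∷_ (cong₂ _xor_ (∧-identityʳ a) (trans (cong (c ·_) (map-const vs false)) (·-𝟎 c)))
                 (cong (_⊕ combo c vs) (•-zeroʳ a)) ⟩
  (a xor false) ∷ (𝟎 ⊕ combo c vs)
    ≡⟨ cong₂ _∷_ (xor-identityʳ a) (⊕-identityˡ (combo c vs)) ⟩
  a ∷ combo c vs ∎
  where open ≡-Reasoning

combo-basis : ∀ {n} (w : Word n) → combo w basis ≡ w
combo-basis [] = refl
combo-basis (a ∷ w) = trans (combo-extend a w basis) (cong (a ∷_) (combo-basis w))

module _ {n} {f : Word n → Bool} (f-linear : IsLinear f) where

  linear-𝟎 : f 𝟎 ≡ false
  linear-𝟎 = begin
    f 𝟎              ≡⟨ cong f (sym (⊕-self 𝟎)) ⟩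
    f (𝟎 ⊕ 𝟎)        ≡⟨ f-linear 𝟎 𝟎 ⟩
    f 𝟎 xor f 𝟎      ≡⟨ xor-same (f 𝟎) ⟩
    false            ∎
    where open ≡-Reasoning

  linear-• : ∀ a v → f (a • v) ≡ a ∧ f v
  linear-• false v = trans (cong f (•-zeroˡ v)) linear-𝟎
  linear-• true v = cong f (•-identityˡ v)

  linear-combo : ∀ {k} (c : Vec Bool k) vs → f (combo c vs) ≡ c · map f vs
  linear-combo [] [] = linear-𝟎
  linear-combo (a ∷ c) (v ∷ vs) =
    trans (f-linear (a • v) (combo c vs)) (cong₂ _xor_ (linear-• a v) (linear-combo c vs))

  linear⇒dot : ∀ w → f w ≡ map f basis · w
  linear⇒dot w = begin
    f w                     ≡⟨ cong f (sym (combo-basis w)) ⟩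
    f (combo w basis)       ≡⟨ linear-combo w basis ⟩
    w · map f basis         ≡⟨ ·-comm w (map f basis) ⟩
    map f basis · w         ∎
    where open ≡-Reasoning

-- Counting words

-- Words of length n are binary numerals for Fin (2 ^ n), which makes pigeonhole available.
bit : Bool → Fin 2
bit false = zero
bit true = suc zero

unbit : Fin 2 → Bool
unbit zero = false
unbit (suc zero) = true

encode : ∀ {n} → Word n → Fin (2 ^ n)
encode [] = zero
encode (a ∷ w) = combine (bit a) (encode w)

decode : ∀ {n} → Fin (2 ^ n) → Word n
decode {zero} _ = []
decode {suc n} i = unbit (proj₁ (remQuot {2} (2 ^ n) i)) ∷ decode (proj₂ (remQuot {2} (2 ^ n) i))

decode-encode : ∀ {n} (w : Word n) → decode (encode w) ≡ w
decode-encode [] = refl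
decode-encode {suc n} (a ∷ w) = begin
  decode {suc n} (encode (a ∷ w))
    ≡⟨ cong (λ (q , r) → unbit q ∷ decode {n} r) (remQuot-combine {2} {2 ^ n} (bit a) (encode w)) ⟩
  unbit (bit a) ∷ decode (encode w)
    ≡⟨ cong₂ _∷_ (unbit-bit a) (decode-encode w) ⟩
  a ∷ w ∎
  where
  open ≡-Reasoning
  unbit-bit : ∀ a → unbit (bit a) ≡ a
  unbit-bit false = refl
  unbit-bit true = refl

encode-decode : ∀ {n} (i : Fin (2 ^ n)) → encode (decode {n} i) ≡ i
encode-decode {zero} zero = refl
encode-decode {suc n} i = begin
  combine (bit (unbit q)) (encode (decode {n} r))  ≡⟨ cong₂ combine (bit-unbit q) (encode-decode {n} r) ⟩
  combine q r                                  ≡⟨ combine-remQuot {2} (2 ^ n) i ⟩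
  i                                            ∎
  where
  open ≡-Reasoning
  q = proj₁ (remQuot {2} (2 ^ n) i)
  r = proj₂ (remQuot {2} (2 ^ n) i)
  bit-unbit : ∀ b → bit (unbit b) ≡ b
  bit-unbit zero = refl
  bit-unbit (suc zero) = refl

encode-injective : ∀ {n} {u v : Word n} → encode u ≡ encode v → u ≡ v
encode-injective {u = u} {v} e =
  trans (sym (decode-encode u)) (trans (cong decode e) (decode-encode v))

decode-injective : ∀ {n} {i j : Fin (2 ^ n)} → decode {n} i ≡ decode j → i ≡ j
decode-injective {n} {i} {j} e =
  trans (sym (encode-decode {n} i)) (trans (cong encode e) (encode-decode {n} j))

pigeonhole-Word : ∀ {k n} → k < n → (f : Word n → Word k) → ∃₂ λ u v → u ≢ v × f u ≡ f v
pigeonhole-Word {k} {n} k<n f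
  with i , j , i<j , fi≡fj ← pigeonhole (^-monoʳ-< 2 (s<s z<s) k<n) (encode ∘ f ∘ decode)
  = decode i , decode j , <⇒≢ i<j ∘ decode-injective , encode-injective fi≡fj

¬surjection : ∀ {k n} → k < n → (f : Word k → Word n) → ¬ (∀ w → ∃ λ c → f c ≡ w)
¬surjection k<n f surjective
  with u , v , u≢v , same ← pigeonhole-Word k<n (proj₁ ∘ surjective) = u≢v (begin
    u                        ≡⟨ sym (proj₂ (surjective u)) ⟩
    f (proj₁ (surjective u)) ≡⟨ cong f same ⟩
    f (proj₁ (surjective v)) ≡⟨ proj₂ (surjective v) ⟩
    v                        ∎)
  where open ≡-Reasoning

any-Word? : ∀ {k} {P : Word k → Set} → Decidable P → Dec (∃ P)
any-Word? {P = P} P? = map′ (λ (i , p) → decode i , p)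
                             (λ (w , p) → encode w , subst P (sym (decode-encode w)) p)
                             (any? (P? ∘ decode))

dependent : ∀ {n k} → n < k → (b : Vec (Word n) k) → ∃ λ c → c ≢ 𝟎 × combo c b ≡ 𝟎
dependent n<k b with c , d , c≢d , same ← pigeonhole-Word n<k (λ c → combo c b) =
  c ⊕ d , c≢d ∘ ⊕≡𝟎⇒≡ , (begin
    combo (c ⊕ d) b           ≡⟨ combo-⊕ c d b ⟩
    combo c b ⊕ combo d b     ≡⟨ cong (_⊕ combo d b) same ⟩
    combo d b ⊕ combo d b     ≡⟨ ⊕-self (combo d b) ⟩
    𝟎                         ∎)
  where open ≡-Reasoning

-- Subspaces of codimension one

module Subspace {n k} {C : Code n} (C-dim : IsSubspaceOfDim k C) where

  B : Vec (Word n) k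
  B = proj₁ C-dim

  independent : LinIndep B
  independent = proj₁ (proj₂ C-dim)

  span : ∀ w → C w ⇔ (∃ λ c → combo c B ≡ w)
  span = proj₂ (proj₂ C-dim)

  ∈-span : ∀ {w} c → combo c B ≡ w → C w
  ∈-span c e = Equivalence.from (span _) (c , e)

  ∈-⊕ : ∀ {u v} → C u → C v → C (u ⊕ v)
  ∈-⊕ {u} {v} u∈ v∈ with c , refl ← Equivalence.to (span u) u∈ | d , refl ← Equivalence.to (span v) v∈ =
    ∈-span (c ⊕ d) (combo-⊕ c d B)

  ∈? : Decidable C
  ∈? w = map′ (λ (c , e) → ∈-span c e) (Equivalence.to (span w))
              (any-Word? (λ c → ≡-dec _≟_ (combo c B) w))

module Codimension1 {m} {C : Code (suc m)} (C-dim : IsSubspaceOfDim m C) where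
  open Subspace C-dim

  -- u, v and the m words of B are dependent, and by independence of B the relation involves u or v.
  ∉-⊕ : ∀ {u v} → ¬ C u → ¬ C v → C (u ⊕ v)
  ∉-⊕ {u} {v} u∉ v∉ with a ∷ b ∷ c , abc≢𝟎 , e ← dependent (n<1+n (suc m)) (u ∷ v ∷ B) =
    cases a b abc≢𝟎 (sym (⊕≡𝟎⇒≡ (trans (⊕-assoc (a • u) (b • v) (combo c B)) e)))
    where
    cases : ∀ a b → a ∷ b ∷ c ≢ 𝟎 → combo c B ≡ a • u ⊕ b • v → C (u ⊕ v)
    cases true true _ e =
      ∈-span c (trans e (cong₂ _⊕_ (•-identityˡ u) (•-identityˡ v)))
    cases true false _ e =
      ⊥-elim (u∉ (∈-span c (trans e (trans (cong₂ _⊕_ (•-identityˡ u) (•-zeroˡ v)) (⊕-identityʳ u)))))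
    cases false true _ e =
      ⊥-elim (v∉ (∈-span c (trans e (trans (cong₂ _⊕_ (•-zeroˡ u) (•-identityˡ v)) (⊕-identityˡ v)))))
    cases false false abc≢𝟎 e =
      ⊥-elim (abc≢𝟎 (cong (λ c → false ∷ false ∷ c)
        (independent c (trans e (trans (cong₂ _⊕_ (•-zeroˡ u) (•-zeroˡ v)) (⊕-identityˡ 𝟎))))))

  proper : ¬ (∀ w → C w)
  proper all = ¬surjection (n<1+n m) (λ c → combo c B) (λ w → Equivalence.to (span w) (all w))

  χ : Word (suc m) → Bool
  χ w = isNo (∈? w)

  χ-∈ : ∀ {w} → C w → χ w ≡ false
  χ-∈ {w} w∈ with ∈? w
  ... | yes _ = refl
  ... | no w∉ = ⊥-elim (w∉ w∈)

  χ-∉ : ∀ {w} → ¬ C w → χ w ≡ true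
  χ-∉ {w} w∉ with ∈? w
  ... | yes w∈ = ⊥-elim (w∉ w∈)
  ... | no _ = refl

  χ-linear : IsLinear χ
  χ-linear u v with ∈? u | ∈? v
  ... | yes u∈ | yes v∈ = χ-∈ (∈-⊕ u∈ v∈)
  ... | yes u∈ | no v∉ = χ-∉ λ uv∈ → v∉ (subst C (⊕-cancelˡ u v) (∈-⊕ u∈ uv∈))
  ... | no u∉ | yes v∈ = χ-∉ λ uv∈ → u∉ (subst C (⊕-cancelʳ u v) (∈-⊕ uv∈ v∈))
  ... | no u∉ | no v∉ = χ-∈ (∉-⊕ u∉ v∉)

  normal : Word (suc m)
  normal = map χ basis

  normal-spec : ∀ w → C w ⇔ normal · w ≡ false
  normal-spec w = mk⇔ (λ w∈ → trans (sym (linear⇒dot χ-linear w)) (χ-∈ w∈)) from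
    where
    from : normal · w ≡ false → C w
    from e with ∈? w
    ... | yes w∈ = w∈
    ... | no w∉ with () ← trans (sym (χ-∉ w∉)) (trans (linear⇒dot χ-linear w) e)

  normal-·-self : IsLCD C → normal · normal ≡ true
  normal-·-self lcd with normal · normal in e
  ... | true = refl
  ... | false =
    ⊥-elim (proper λ w → Equivalence.from (normal-spec w) (trans (cong (_· w) normal≡𝟎) (𝟎-· w)))
    where
    normal≡𝟎 : normal ≡ 𝟎
    normal≡𝟎 = lcd normal (Equivalence.from (normal-spec normal) e)
                 λ c c∈ → trans (·-comm c normal) (Equivalence.to (normal-spec c) c∈)

-- Hyperplanes h⊥

Hyperplane : ∀ {n} → Word n → Code n
Hyperplane h w = h · w ≡ false

xor≡false⇒≡ : ∀ {a b} → a xor b ≡ false → a ≡ b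
xor≡false⇒≡ {false} {false} _ = refl
xor≡false⇒≡ {true} {true} _ = refl

-- Pivot on the first coordinate of h: if it is 1, it is determined by the others, and h⊥ is
-- the graph of v ↦ h · v; if it is 0, it is free and the rest is a hyperplane one dimension lower.
hyperplane-isSubspace : ∀ {m} (h : Word (suc m)) → h ≢ 𝟎 → IsSubspaceOfDim m (Hyperplane h)
hyperplane-isSubspace (true ∷ h) _ = map (λ v → (h · v) ∷ v) basis , independent , span
  where
  graph : ∀ c → combo c (map (λ v → (h · v) ∷ v) basis) ≡ (h · c) ∷ c
  graph c = begin
    combo c (map (λ v → (h · v) ∷ v) basis)     ≡⟨ combo-map-∷ (h ·_) c basis ⟩
    (c · map (h ·_) basis) ∷ combo c basis       ≡⟨ cong (_∷ combo c basis) (sym (linear-combo (·-distribˡ-⊕ h) c basis)) ⟩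
    (h · combo c basis) ∷ combo c basis          ≡⟨ cong (λ w → (h · w) ∷ w) (combo-basis c) ⟩
    (h · c) ∷ c                                  ∎
    where open ≡-Reasoning
  independent : LinIndep (map (λ v → (h · v) ∷ v) basis)
  independent c e = ∷-injectiveʳ (trans (sym (graph c)) e)
  span : ∀ w → Hyperplane (true ∷ h) w ⇔ ∃ λ c → combo c (map (λ v → (h · v) ∷ v) basis) ≡ w
  span (a ∷ w) = mk⇔ (λ e → w , trans (graph w) (cong (_∷ w) (sym (xor≡false⇒≡ e))))
                     (λ (c , e) → subst (Hyperplane (true ∷ h)) (trans (sym (graph c)) e) (xor-same (h · c)))
hyperplane-isSubspace {zero} (false ∷ []) h≢𝟎 = ⊥-elim (h≢𝟎 refl)
hyperplane-isSubspace {suc m} (false ∷ h) h≢𝟎 = (true ∷ 𝟎) ∷ map (false ∷_) B , independent , span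
  where
  open Subspace (hyperplane-isSubspace h (h≢𝟎 ∘ cong (false ∷_)))
    using (B) renaming (independent to B-independent; span to B-span)
  independent : LinIndep ((true ∷ 𝟎) ∷ map (false ∷_) B)
  independent (a ∷ c) e with e′ ← trans (sym (combo-extend a c B)) e =
    cong₂ _∷_ (∷-injectiveˡ e′) (B-independent c (∷-injectiveʳ e′))
  span : ∀ w → Hyperplane (false ∷ h) w ⇔ ∃ λ c → combo c ((true ∷ 𝟎) ∷ map (false ∷_) B) ≡ w
  span (a ∷ w) = mk⇔
    (λ e → let c , e′ = Equivalence.to (B-span w) e in a ∷ c , trans (combo-extend a c B) (cong (a ∷_) e′))
    (λ { (b ∷ c , e) → Equivalence.from (B-span w) (c , ∷-injectiveʳ (trans (sym (combo-extend b c B)) e)) })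

·-nondegenerate : ∀ {n} (w : Word n) → (∀ v → v · w ≡ false) → w ≡ 𝟎
·-nondegenerate [] _ = refl
·-nondegenerate (a ∷ w) ⊥w =
  cong₂ _∷_ (trans (sym (xor-identityʳ a)) (trans (cong (a xor_) (sym (𝟎-· w))) (⊥w (true ∷ 𝟎))))
            (·-nondegenerate w (⊥w ∘ (false ∷_)))

-- Since h · h = 1, v ⊕ (h · v) h lies in h⊥, and it has the same product as v with any w ∈ h⊥.
hyperplane-LCD : ∀ {n} (h : Word n) → h · h ≡ true → IsLCD (Hyperplane h)
hyperplane-LCD h h·h w h·w w∈dual = ·-nondegenerate w λ v → begin
    v · w                              ≡⟨ xor-identityʳ (v · w) ⟨
    (v · w) xor false                  ≡⟨ cong ((v · w) xor_) (multiple-of-h-· v) ⟨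
    (v · w) xor (((h · v) • h) · w)    ≡⟨ ·-distribʳ-⊕ v ((h · v) • h) w ⟨
    (v ⊕ (h · v) • h) · w              ≡⟨ w∈dual (v ⊕ (h · v) • h) (projection∈ v) ⟩
    false                              ∎
  where
  open ≡-Reasoning
  multiple-of-h-· : ∀ v → ((h · v) • h) · w ≡ false
  multiple-of-h-· v = trans (•-· (h · v) h w) (trans (cong ((h · v) ∧_) h·w) (∧-zeroʳ (h · v)))
  projection∈ : ∀ v → Hyperplane h (v ⊕ (h · v) • h)
  projection∈ v = begin
    h · (v ⊕ (h · v) • h)              ≡⟨ ·-distribˡ-⊕ h v ((h · v) • h) ⟩
    (h · v) xor (h · ((h · v) • h))    ≡⟨ cong ((h · v) xor_) (trans (·-comm h _) (•-· (h · v) h h)) ⟩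
    (h · v) xor ((h · v) ∧ (h · h))    ≡⟨ cong (λ b → (h · v) xor ((h · v) ∧ b)) h·h ⟩
    (h · v) xor ((h · v) ∧ true)       ≡⟨ cong ((h · v) xor_) (∧-identityʳ (h · v)) ⟩
    (h · v) xor (h · v)                ≡⟨ xor-same (h · v) ⟩
    false                              ∎

Hyperplane-injective : ∀ {n} {g h : Word n} → (∀ v → Hyperplane g v ⇔ Hyperplane h v) → g ≡ h
Hyperplane-injective {g = g} {h} same = ⊕≡𝟎⇒≡ (·-nondegenerate (g ⊕ h) λ v →
  trans (·-comm v (g ⊕ h)) (trans (·-distribʳ-⊕ g h v) (xor-⇔ (same v))))
  where
  xor-⇔ : ∀ {a b} → a ≡ false ⇔ b ≡ false → a xor b ≡ false
  xor-⇔ {false} {false} _ = refl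
  xor-⇔ {false} {true} a⇔b = Equivalence.to a⇔b refl
  xor-⇔ {true} {false} a⇔b = Equivalence.from a⇔b refl
  xor-⇔ {true} {true} _ = refl

-- Weight and parity

parity : ℕ → Bool
parity zero = false
parity (suc k) = not (parity k)

·-self : ∀ {n} (w : Word n) → w · w ≡ parity (wt w)
·-self [] = refl
·-self (false ∷ w) = ·-self w
·-self (true ∷ w) = cong not (·-self w)

𝟙-· : ∀ {n} (w : Word n) → replicate n true · w ≡ parity (wt w)
𝟙-· [] = refl
𝟙-· (false ∷ w) = 𝟙-· w
𝟙-· (true ∷ w) = cong not (𝟙-· w)

wt-𝟎 : ∀ n → wt (𝟎 {n}) ≡ 0
wt-𝟎 zero = refl
wt-𝟎 (suc n) = wt-𝟎 n

wt-𝟙 : ∀ n → wt (replicate n true) ≡ n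
wt-𝟙 zero = refl
wt-𝟙 (suc n) = cong suc (wt-𝟙 n)

wt≡0⇒𝟎 : ∀ {n} (w : Word n) → wt w ≡ 0 → w ≡ 𝟎
wt≡0⇒𝟎 [] _ = refl
wt≡0⇒𝟎 (false ∷ w) e = cong (false ∷_) (wt≡0⇒𝟎 w e)

wt≤n : ∀ {n} (w : Word n) → wt w ≤ n
wt≤n [] = z≤n
wt≤n (true ∷ w) = s≤s (wt≤n w)
wt≤n (false ∷ w) = m≤n⇒m≤1+n (wt≤n w)

ones : ∀ n → ℕ → Word n
ones zero _ = []
ones (suc n) zero = false ∷ ones n zero
ones (suc n) (suc t) = true ∷ ones n t

wt-ones : ∀ {n t} → t ≤ n → wt (ones n t) ≡ t
wt-ones {zero} z≤n = refl
wt-ones {suc n} z≤n = wt-ones {n} z≤n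
wt-ones (s≤s t≤n) = cong suc (wt-ones t≤n)

unitAt : ∀ n → ℕ → Word n
unitAt zero _ = []
unitAt (suc n) zero = true ∷ 𝟎
unitAt (suc n) (suc t) = false ∷ unitAt n t

wt-unitAt : ∀ {n t} → t < n → wt (unitAt n t) ≡ 1
wt-unitAt {suc n} {zero} _ = cong suc (wt-𝟎 n)
wt-unitAt {suc n} {suc t} (s≤s t<n) = wt-unitAt t<n

ones-·-unitAt : ∀ n t → ones n t · unitAt n t ≡ false
ones-·-unitAt zero t = refl
ones-·-unitAt (suc n) zero = ·-𝟎 (ones n zero)
ones-·-unitAt (suc n) (suc t) = ones-·-unitAt n t

parity-even : ∀ j → parity (j * 2) ≡ false
parity-even zero = refl
parity-even (suc j) = trans (not-involutive _) (parity-even j)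

parity-odd : ∀ j → parity (suc (j * 2)) ≡ true
parity-odd j = cong not (parity-even j)

even-or-odd : ∀ k → (∃ λ j → k ≡ j * 2) ⊎ (∃ λ j → k ≡ suc (j * 2))
even-or-odd zero = inj₁ (0 , refl)
even-or-odd (suc k) with even-or-odd k
... | inj₁ (j , refl) = inj₂ (j , refl)
... | inj₂ (j , refl) = inj₁ (suc j , refl)

parity≡true⇒odd : ∀ k → parity k ≡ true → ∃ λ j → k ≡ suc (j * 2)
parity≡true⇒odd k p with even-or-odd k
... | inj₂ odd = odd
... | inj₁ (j , refl) with () ← trans (sym p) (parity-even j)

¬2∣⇒parity≡true : ∀ n → ¬ (2 ∣ n) → parity n ≡ true
¬2∣⇒parity≡true n 2∤n with even-or-odd n
... | inj₁ (j , n≡2j) = ⊥-elim (2∤n (divides j n≡2j))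
... | inj₂ (j , refl) = parity-odd j

map-basis : ∀ {n} (f : Word n → Bool) → (∀ w → wt w ≡ 1 → f w ≡ true) → map f basis ≡ replicate n true
map-basis {zero} f _ = refl
map-basis {suc n} f unit⇒true =
  cong₂ _∷_ (unit⇒true (true ∷ 𝟎) (cong suc (wt-𝟎 n)))
            (trans (sym (map-∘ f (false ∷_) basis)) (map-basis (f ∘ (false ∷_)) (unit⇒true ∘ (false ∷_))))

wt≡1⇒≢𝟎 : ∀ {n} {w : Word n} → wt w ≡ 1 → w ≢ 𝟎
wt≡1⇒≢𝟎 {n} wt≡1 refl with () ← trans (sym wt≡1) (wt-𝟎 n)

≢𝟎⇒1≤wt : ∀ {n} (w : Word n) → w ≢ 𝟎 → 1 ≤ wt w
≢𝟎⇒1≤wt w w≢𝟎 with wt w in eq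
... | zero = ⊥-elim (w≢𝟎 (wt≡0⇒𝟎 w eq))
... | suc _ = s≤s z≤n

-- Coordinate permutations

lookup-permute : ∀ {n} (σ : Permutation′ n) w i → lookup (permute σ w) i ≡ lookup w (σ ⟨$⟩ʳ i)
lookup-permute σ w i = lookup∘tabulate _ i

permute-id : ∀ {n} (w : Word n) → permute Perm.id w ≡ w
permute-id = tabulate∘lookup

permute-∘ : ∀ {n} (π ρ : Permutation′ n) w → permute (π ∘ₚ ρ) w ≡ permute π (permute ρ w)
permute-∘ π ρ w = tabulate-cong λ i → sym (lookup-permute ρ w (π ⟨$⟩ʳ i))

permute-flip : ∀ {n} (σ : Permutation′ n) w → permute σ (permute (Perm.flip σ) w) ≡ w
permute-flip σ w = trans (tabulate-cong λ i → trans (lookup-permute (Perm.flip σ) w (σ ⟨$⟩ʳ i))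
                                                   (cong (lookup w) (Perm.inverseˡ σ)))
                         (tabulate∘lookup w)

module ℕ-Sum = CommutativeMonoidSum +-0-commutativeMonoid
module xor-Sum = CommutativeMonoidSum (CommutativeRing.+-commutativeMonoid xor-∧-commutativeRing)

wt≡sum : ∀ {n} (w : Word n) → wt w ≡ ℕ-Sum.sum (λ i → if lookup w i then 1 else 0)
wt≡sum [] = refl
wt≡sum (true ∷ w) = cong suc (wt≡sum w)
wt≡sum (false ∷ w) = wt≡sum w

·≡sum : ∀ {n} (u v : Word n) → u · v ≡ xor-Sum.sum (λ i → lookup u i ∧ lookup v i)
·≡sum [] [] = refl
·≡sum (a ∷ u) (b ∷ v) = cong ((a ∧ b) xor_) (·≡sum u v)

wt-permute : ∀ {n} (σ : Permutation′ n) w → wt (permute σ w) ≡ wt w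
wt-permute σ w = begin
  wt (permute σ w)
    ≡⟨ wt≡sum (permute σ w) ⟩
  ℕ-Sum.sum (λ i → if lookup (permute σ w) i then 1 else 0)
    ≡⟨ ℕ-Sum.sum-cong-≗ (λ i → cong (if_then 1 else 0) (lookup-permute σ w i)) ⟩
  ℕ-Sum.sum (λ i → if lookup w (σ ⟨$⟩ʳ i) then 1 else 0)
    ≡⟨ ℕ-Sum.sum-permute (λ i → if lookup w i then 1 else 0) σ ⟨
  ℕ-Sum.sum (λ i → if lookup w i then 1 else 0)
    ≡⟨ wt≡sum w ⟨
  wt w ∎
  where open ≡-Reasoning

·-permute : ∀ {n} (σ : Permutation′ n) u v → permute σ u · permute σ v ≡ u · v
·-permute σ u v = begin
  permute σ u · permute σ v
    ≡⟨ ·≡sum (permute σ u) (permute σ v) ⟩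
  xor-Sum.sum (λ i → lookup (permute σ u) i ∧ lookup (permute σ v) i)
    ≡⟨ xor-Sum.sum-cong-≗ (λ i → cong₂ _∧_ (lookup-permute σ u i) (lookup-permute σ v i)) ⟩
  xor-Sum.sum (λ i → lookup u (σ ⟨$⟩ʳ i) ∧ lookup v (σ ⟨$⟩ʳ i))
    ≡⟨ xor-Sum.sum-permute (λ i → lookup u i ∧ lookup v i) σ ⟨
  xor-Sum.sum (λ i → lookup u i ∧ lookup v i)
    ≡⟨ ·≡sum u v ⟨
  u · v ∎
  where open ≡-Reasoning

permute-swap : ∀ {n} x y (w : Word n) → permute (Perm.transpose 0F 1F) (x ∷ y ∷ w) ≡ y ∷ x ∷ w
permute-swap x y w = cong (λ v → y ∷ x ∷ v) (tabulate∘lookup w)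

rotate : ∀ m t → t ≤ m → Permutation′ (suc m)
rotate m zero _ = Perm.id
rotate (suc m) (suc t) (s≤s t≤m) = Perm.lift₀ (rotate m t t≤m) ∘ₚ Perm.transpose 0F 1F

rotate-ones : ∀ m t (t≤m : t ≤ m) → permute (rotate m t t≤m) (false ∷ ones m t) ≡ ones (suc m) t
rotate-ones m zero _ = permute-id (false ∷ ones m zero)
rotate-ones (suc m) (suc t) (s≤s t≤m) = begin
  permute (Perm.lift₀ ρ ∘ₚ Perm.transpose 0F 1F) (false ∷ true ∷ ones m t)
    ≡⟨ permute-∘ (Perm.lift₀ ρ) (Perm.transpose 0F 1F) (false ∷ true ∷ ones m t) ⟩
  permute (Perm.lift₀ ρ) (permute (Perm.transpose 0F 1F) (false ∷ true ∷ ones m t))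
    ≡⟨ cong (permute (Perm.lift₀ ρ)) (permute-swap false true (ones m t)) ⟩
  true ∷ permute ρ (false ∷ ones m t)
    ≡⟨ cong (true ∷_) (rotate-ones m t t≤m) ⟩
  true ∷ ones (suc m) t ∎
  where
  open ≡-Reasoning
  ρ = rotate m t t≤m

permute-to-ones : ∀ {n} (h : Word n) → ∃ λ σ → permute σ h ≡ ones n (wt h)
permute-to-ones [] = Perm.id , refl
permute-to-ones (true ∷ h) with σ , e ← permute-to-ones h = Perm.lift₀ σ , cong (true ∷_) e
permute-to-ones {suc m} (false ∷ h) with σ , e ← permute-to-ones h =
  rotate m (wt h) (wt≤n h) ∘ₚ Perm.lift₀ σ , (begin
    permute (rotate m (wt h) (wt≤n h) ∘ₚ Perm.lift₀ σ) (false ∷ h)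
      ≡⟨ permute-∘ (rotate m (wt h) (wt≤n h)) (Perm.lift₀ σ) (false ∷ h) ⟩
    permute (rotate m (wt h) (wt≤n h)) (false ∷ permute σ h)
      ≡⟨ cong (λ w → permute (rotate m (wt h) (wt≤n h)) (false ∷ w)) e ⟩
    permute (rotate m (wt h) (wt≤n h)) (false ∷ ones m (wt h))
      ≡⟨ rotate-ones m (wt h) (wt≤n h) ⟩
    ones (suc m) (wt h) ∎)
  where open ≡-Reasoning

Hyperplane-permute : ∀ {n} (σ : Permutation′ n) {g h : Word n} → permute σ g ≡ h →
                     Equivalent (Hyperplane g) (Hyperplane h)
Hyperplane-permute σ {g} refl = σ , λ w → begin
  Hyperplane g w                         ≡⟨ cong (_≡ false) (·-permute σ g w) ⟨
  Hyperplane (permute σ g) (permute σ w) ∎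
  where open ⇔-Reasoning

Hyperplane-equivalent⇒wt≡ : ∀ {n} {g h : Word n} → Equivalent (Hyperplane g) (Hyperplane h) → wt g ≡ wt h
Hyperplane-equivalent⇒wt≡ {g = g} {h} (σ , g~h) = trans (sym (wt-permute σ g)) (cong wt σg≡h)
  where
  σg≡h : permute σ g ≡ h
  σg≡h = Hyperplane-injective λ v → let w = permute (Perm.flip σ) v in begin
    Hyperplane (permute σ g) v             ≡⟨ cong (Hyperplane (permute σ g)) (permute-flip σ v) ⟨
    Hyperplane (permute σ g) (permute σ w) ≡⟨ cong (_≡ false) (·-permute σ g w) ⟩
    Hyperplane g w                         ≈⟨ g~h w ⟩
    Hyperplane h (permute σ w)             ≡⟨ cong (Hyperplane h) (permute-flip σ v) ⟩
    Hyperplane h v                         ∎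
    where open ⇔-Reasoning

Equivalent-respˡ : ∀ {n} {C C′ D : Code n} → (∀ w → C w ⇔ C′ w) → Equivalent C′ D → Equivalent C D
Equivalent-respˡ C≐C′ (σ , C′~D) = σ , λ w → ⇔-trans (C≐C′ w) (C′~D w)

≐⇒Equivalent : ∀ {n} {C D : Code n} → (∀ w → C w ⇔ D w) → Equivalent C D
≐⇒Equivalent {C = C} {D} C≐D = Perm.id , λ w → begin
  C w                  ≈⟨ C≐D w ⟩
  D w                  ≡⟨ cong D (permute-id w) ⟨
  D (permute Perm.id w) ∎
  where open ⇔-Reasoning

-- Binary LCD [n, n − 1] codes

minWeight2⇒evenWeight : ∀ {m} {C : Code (suc m)} → IsCode (suc m) m 2 C →
                        ∀ w → C w ⇔ Hyperplane (replicate (suc m) true) w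
minWeight2⇒evenWeight {C = C} (C-dim , _ , 2≤wt) w =
  subst (λ h → C w ⇔ Hyperplane h w) normal≡𝟙 (normal-spec w)
  where
  open Codimension1 C-dim
  normal≡𝟙 : normal ≡ replicate _ true
  normal≡𝟙 = map-basis χ λ v wt≡1 → χ-∉ λ v∈ → 2≰1 (subst (2 ≤_) wt≡1 (2≤wt v v∈ (wt≡1⇒≢𝟎 wt≡1)))
    where
    2≰1 : ¬ 2 ≤ 1
    2≰1 (s≤s ())

evenWeight-isCode : ∀ m → IsCode (suc (suc m)) (suc m) 2 (Hyperplane (replicate (suc (suc m)) true))
evenWeight-isCode m =
  hyperplane-isSubspace (replicate _ true) (λ ()) ,
  (true ∷ true ∷ 𝟎 , trans (𝟙-· (true ∷ true ∷ 𝟎 {m})) (cong (parity ∘ (2 +_)) (wt-𝟎 m)) ,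
   (λ ()) , cong (2 +_) (wt-𝟎 m)) ,
  λ w w∈ w≢𝟎 → even⇒2≤ (wt w) (trans (sym (𝟙-· w)) w∈) (≢𝟎⇒1≤wt w w≢𝟎)
  where
  even⇒2≤ : ∀ k → parity k ≡ false → 1 ≤ k → 2 ≤ k
  even⇒2≤ (suc zero) () _
  even⇒2≤ (suc (suc k)) _ _ = s≤s (s≤s z≤n)

oddWeight-LCDCode : ∀ {m t} → t < suc m → parity t ≡ true →
                    LCDCode (suc m) m 1 (Hyperplane (ones (suc m) t))
oddWeight-LCDCode {m} {t} t<n t-odd =
  (hyperplane-isSubspace h h≢𝟎 ,
   (unitAt (suc m) t , ones-·-unitAt (suc m) t , wt≡1⇒≢𝟎 (wt-unitAt t<n) , wt-unitAt t<n) ,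
   λ w _ → ≢𝟎⇒1≤wt w) ,
  hyperplane-LCD h h·h
  where
  h = ones (suc m) t
  h·h : h · h ≡ true
  h·h = trans (·-self h) (trans (cong parity (wt-ones (<⇒≤ t<n))) t-odd)
  h≢𝟎 : h ≢ 𝟎
  h≢𝟎 h≡𝟎 with () ← trans (sym h·h) (trans (cong (λ x → x · x) h≡𝟎) (𝟎-· (𝟎 {suc m})))

LCD-codim1-classification : ∀ {m d} {C : Code (suc m)} → LCDCode (suc m) m d C →
  ∃ λ t → t ≤ suc m × parity t ≡ true × Equivalent C (Hyperplane (ones (suc m) t))
LCD-codim1-classification ((C-dim , _) , lcd) =
  wt normal , wt≤n normal , trans (sym (·-self normal)) (normal-·-self lcd) ,
  Equivalent-respˡ {C′ = Hyperplane normal} {Hyperplane (ones _ (wt normal))} normal-spec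
    (Hyperplane-permute (proj₁ sorted) {normal} (proj₂ sorted))
  where
  open Codimension1 C-dim
  sorted : ∃ λ σ → permute σ normal ≡ ones (suc _) (wt normal)
  sorted = permute-to-ones normal

oddLength-unique : ∀ n → 3 ≤ n → ¬ (2 ∣ n) →
  (∃ λ C → LCDCode n (n ∸ 1) 2 C)
  × (∀ C D → LCDCode n (n ∸ 1) 2 C → LCDCode n (n ∸ 1) 2 D → Equivalent C D)
oddLength-unique n@(suc (suc (suc m))) (s≤s (s≤s (s≤s _))) 2∤n =
  (Hyperplane 𝟙 , evenWeight-isCode (suc m) ,
   hyperplane-LCD 𝟙 (trans (𝟙-· 𝟙) (trans (cong parity (wt-𝟙 n)) (¬2∣⇒parity≡true n 2∤n)))) ,
  λ C D (C-code , _) (D-code , _) →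
    ≐⇒Equivalent λ w → ⇔-trans (minWeight2⇒evenWeight C-code w) (⇔-sym (minWeight2⇒evenWeight D-code w))
  where 𝟙 = replicate n true

evenLength-classes : ∀ n → 2 ≤ n → 2 ∣ n →
  ∃ λ (F : Fin (n / 2) → Code n) →
    (∀ i → LCDCode n (n ∸ 1) 1 (F i))
    × (∀ i j → Equivalent (F i) (F j) → i ≡ j)
    × (∀ C → LCDCode n (n ∸ 1) 1 C → ∃ λ i → Equivalent C (F i))
evenLength-classes _ _ (divides (suc q) refl) = F , F-LCD , F-inequivalent , F-complete
  where
  n = suc q * 2
  n/2≡ : n / 2 ≡ suc q
  n/2≡ = m*n/n≡m (suc q) 2
  weight : Fin (n / 2) → ℕ
  weight i = suc (toℕ i * 2)
  weight<n : ∀ i → weight i < n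
  weight<n i = *-monoˡ-≤ 2 (subst (toℕ i <_) n/2≡ (toℕ<n i))
  F : Fin (n / 2) → Code n
  F i = Hyperplane (ones n (weight i))
  F-LCD : ∀ i → LCDCode n (n ∸ 1) 1 (F i)
  F-LCD i = oddWeight-LCDCode (weight<n i) (parity-odd (toℕ i))
  F-inequivalent : ∀ i j → Equivalent (F i) (F j) → i ≡ j
  F-inequivalent i j Fi~Fj = toℕ-injective (*-cancelʳ-≡ (toℕ i) (toℕ j) 2 (suc-injective (begin
    weight i                  ≡⟨ wt-ones (<⇒≤ (weight<n i)) ⟨
    wt (ones n (weight i))    ≡⟨ Hyperplane-equivalent⇒wt≡ {g = ones n (weight i)} {ones n (weight j)} Fi~Fj ⟩
    wt (ones n (weight j))    ≡⟨ wt-ones (<⇒≤ (weight<n j)) ⟩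
    weight j                  ∎)))
    where open ≡-Reasoning
  F-complete : ∀ C → LCDCode n (n ∸ 1) 1 C → ∃ λ i → Equivalent C (F i)
  F-complete C C-LCD with LCD-codim1-classification C-LCD
  ... | t , t≤n , t-odd , C~ones with parity≡true⇒odd t t-odd
  ... | x , refl =
    fromℕ< x<n/2 ,
    subst (λ y → Equivalent C (Hyperplane (ones n (suc (y * 2))))) (sym (toℕ-fromℕ< x<n/2)) C~ones
    where
    x<n/2 : x < n / 2
    x<n/2 = subst (x <_) (sym n/2≡) (*-cancelʳ-< 2 x (suc q) t≤n)

proposition2p5 :
    (∀ n → 3 ≤ n → ¬ (2 ∣ n) →
      (∃ λ C → LCDCode n (n ∸ 1) 2 C)
      × (∀ C D → LCDCode n (n ∸ 1) 2 C → LCDCode n (n ∸ 1) 2 D → Equivalent C D))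
    ×
    (∀ n → 2 ≤ n → 2 ∣ n →
      ∃ λ (F : Fin (n / 2) → Code n) →
        (∀ i → LCDCode n (n ∸ 1) 1 (F i))
        × (∀ i j → Equivalent (F i) (F j) → i ≡ j)
        × (∀ C → LCDCode n (n ∸ 1) 1 C → ∃ λ i → Equivalent C (F i)))
proposition2p5 = oddLength-unique , evenLength-classes
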